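{- If $D$ is a strong digraph with $\mathsf{d}_s^-(D)=\delta^+(D)+1$, then $D$ has an in-dominating vertex; moreover, every vertex of $D$ of minimum out-degree is an in-dominating vertex.
   Context: Digraphs are finite, loopless, without parallel arcs. $D$ is strong if for every ordered pair $u,v$ there is a directed $uv$-walk. $S\subseteq V(D)$ is in-dominating if every vertex not in $S$ has an out-neighbor in $S$; a vertex $v$ is in-dominating if $\{v\}$ is in-dominating. A strong in-dominating set is an in-dominating set inducing a strong subdigraph; $\mathsf{d}_s^-(D)$ is the maximum number of classes in a partition of $V(D)$ into strong in-dominating sets. $\delta^+(D)$ is the minimum out-degree. -}

module Defs where

open import Data.Nat using (ℕ; zero; suc; _≤_; _⊓_)
open import Data.Fin using (Fin; zero; suc)
open import Data.Fin.Subset using (∣_∣)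
open import Data.Vec using (tabulate)
open import Data.Bool using (Bool; true; false)
open import Data.Product using (Σ; _×_)
open import Data.Unit using (⊤)
open import Relation.Nullary using (¬_)
open import Relation.Binary.PropositionalEquality using (_≡_)
open import Function using (_∘_)

-- A finite digraph on vertex set Fin n, given by a Boolean arc relation.
-- Loopless; parallel arcs cannot occur with a relation.
record Digraph (n : ℕ) : Set where
  field
    arc      : Fin n → Fin n → Bool
    loopless : ∀ v → arc v v ≡ false
open Digraph public

Arc : ∀ {n} → Digraph n → Fin n → Fin n → Set
Arc D u v = arc D u v ≡ true

VSet : ℕ → Set₁
VSet n = Fin n → Set

outdeg : ∀ {n} → Digraph n → Fin n → ℕ
outdeg D v = ∣ tabulate (arc D v) ∣

minOver : ∀ {n} → (Fin (suc n) → ℕ) → ℕ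
minOver {zero}  f = f zero
minOver {suc n} f = f zero ⊓ minOver (f ∘ suc)

δ⁺ : ∀ {n} → Digraph (suc n) → ℕ
δ⁺ D = minOver (outdeg D)

-- directed walk from u to v using only vertices of S (walk in D[S])
data Walk {n} (D : Digraph n) (S : VSet n) : Fin n → Fin n → Set where
  here : ∀ {u} → S u → Walk D S u u
  step : ∀ {u w v} → S u → Arc D u w → Walk D S w v → Walk D S u v

InducesStrong : ∀ {n} → Digraph n → VSet n → Set
InducesStrong D S = ∀ u v → S u → S v → Walk D S u v

Strong : ∀ {n} → Digraph n → Set
Strong D = ∀ u v → Walk D (λ _ → ⊤) u v

InDominating : ∀ {n} → Digraph n → VSet n → Set
InDominating D S = ∀ v → ¬ S v → Σ _ λ u → S u × Arc D v u

InDominatingVertex : ∀ {n} → Digraph n → Fin n → Set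
InDominatingVertex D v = InDominating D (λ u → u ≡ v)

StrongInDominating : ∀ {n} → Digraph n → VSet n → Set
StrongInDominating D S = InDominating D S × InducesStrong D S

-- a partition of V(D) into k (nonempty) classes, each strong in-dominating;
-- class i is { v | c v ≡ i }, surjectivity makes all classes nonempty
HasSIDPartition : ∀ {n} → Digraph n → ℕ → Set
HasSIDPartition {n} D k =
  Σ (Fin n → Fin k) λ c →
    (∀ i → Σ (Fin n) λ v → c v ≡ i) ×
    (∀ i → StrongInDominating D (λ v → c v ≡ i))

-- d_s^-(D) = m : m is the maximum number of classes of such a partition
IsDsMinus : ∀ {n} → Digraph n → ℕ → Set
IsDsMinus D m = HasSIDPartition D m × (∀ k → HasSIDPartition D k → k ≤ m)

module Submission where

-- A vertex v has an out-neighbour in every class of a strong in-dominating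
-- partition other than its own, since that class is in-dominating; if its own
-- class contains a second vertex, the first arc of a walk inside the class to
-- that vertex gives one more.  Hence a vertex whose out-degree is smaller than
-- the number of classes is alone in its class, and then {v} is in-dominating.
-- A partition into δ⁺(D) + 1 such classes thus makes every vertex of minimum
-- out-degree in-dominating.

open import Defs
open import Data.Nat using (ℕ; zero; suc; _≤_; _<_; z≤n; s≤s)
open import Data.Nat.Properties using (<-≤-trans; ⊓-sel; <⇒≱; ≤-reflexive)
open import Data.Fin using (Fin; zero; suc; _≟_)
open import Data.Fin.Properties using (suc-injective; 0≢1+n)
open import Data.Fin.Subset using (Subset; _∈_; _-_; ∣_∣)
open import Data.Fin.Subset.Properties using (x∈p∧x≢y⇒x∈p-y; x∈p⇒∣p-x∣<∣p∣)
open import Data.Vec using (tabulate)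
open import Data.Vec.Properties using (lookup⇒[]=; lookup∘tabulate)
open import Data.Product using (Σ; _×_; _,_; proj₁; proj₂)
open import Data.Sum using (inj₁; inj₂)
open import Function using (_∘_)
open import Function.Definitions using (Injective)
open import Relation.Nullary using (yes; no; contradiction)
open import Relation.Binary.PropositionalEquality using (_≡_; _≢_; refl; sym; trans; cong)

injective⇒≤∣p∣ : ∀ {m N} (p : Subset N) (f : Fin m → Fin N) →
                 Injective _≡_ _≡_ f → (∀ i → f i ∈ p) → m ≤ ∣ p ∣
injective⇒≤∣p∣ {zero}  p f f-inj f∈p = z≤n
injective⇒≤∣p∣ {suc m} p f f-inj f∈p =
  <-≤-trans (s≤s (injective⇒≤∣p∣ (p - f zero) (f ∘ suc)
                   (suc-injective ∘ f-inj)
                   (λ i → x∈p∧x≢y⇒x∈p-y (f∈p (suc i)) (0≢1+n ∘ sym ∘ f-inj))))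
            (x∈p⇒∣p-x∣<∣p∣ (f∈p zero))

minOver-attained : ∀ {n} (f : Fin (suc n) → ℕ) → Σ (Fin (suc n)) λ v → f v ≡ minOver f
minOver-attained {zero}  f = zero , refl
minOver-attained {suc n} f with ⊓-sel (f zero) (minOver (f ∘ suc))
... | inj₁ f0≡min = zero , sym f0≡min
... | inj₂ rest≡min with minOver-attained (f ∘ suc)
...   | v , fv≡min = suc v , trans fv≡min (sym rest≡min)

arc⇒∈out-neighbours : ∀ {n} (D : Digraph n) {v u} → Arc D v u → u ∈ tabulate (arc D v)
arc⇒∈out-neighbours D {v} {u} v→u = lookup⇒[]= u _ (trans (lookup∘tabulate (arc D v) u) v→u)

walk⇒out-neighbour : ∀ {n} {D : Digraph n} {S : VSet n} {v w} → v ≢ w →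
                     Walk D S v w → Σ (Fin n) λ x → Arc D v x × S x
walk⇒out-neighbour v≢v (here _)                   = contradiction refl v≢v
walk⇒out-neighbour _   (step _ v→x (here Sx))       = _ , v→x , Sx
walk⇒out-neighbour _   (step _ v→x (step Sx _ _))   = _ , v→x , Sx

module _ {n} (D : Digraph n) {m} (c : Fin n → Fin m)
         (sid : ∀ i → StrongInDominating D (λ v → c v ≡ i)) where

  out-neighbour-in-every-class : ∀ v x → Arc D v x → c x ≡ c v →
                                 ∀ i → Σ (Fin n) λ u → Arc D v u × c u ≡ i
  out-neighbour-in-every-class v x v→x cx≡cv i with i ≟ c v
  ... | yes i≡cv = x , v→x , trans cx≡cv (sym i≡cv)
  ... | no  i≢cv with proj₁ (sid i) v (i≢cv ∘ sym)
  ...   | u , cu≡i , v→u = u , v→u , cu≡i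

  classes≤outdeg : ∀ v x → Arc D v x → c x ≡ c v → m ≤ outdeg D v
  classes≤outdeg v x v→x cx≡cv =
    injective⇒≤∣p∣ (tabulate (arc D v)) neighbour neighbour-injective
      (λ i → arc⇒∈out-neighbours D (proj₁ (proj₂ (choice i))))
    where
    choice : ∀ i → Σ (Fin n) λ u → Arc D v u × c u ≡ i
    choice = out-neighbour-in-every-class v x v→x cx≡cv
    neighbour : Fin m → Fin n
    neighbour = proj₁ ∘ choice
    neighbour-injective : Injective _≡_ _≡_ neighbour
    neighbour-injective {i} {j} ui≡uj =
      trans (sym (proj₂ (proj₂ (choice i)))) (trans (cong c ui≡uj) (proj₂ (proj₂ (choice j))))

  outdeg<classes⇒alone-in-class : ∀ v → outdeg D v < m → ∀ w → c w ≡ c v → w ≡ v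
  outdeg<classes⇒alone-in-class v deg<m w cw≡cv with w ≟ v
  ... | yes w≡v = w≡v
  ... | no  w≢v with walk⇒out-neighbour (w≢v ∘ sym) (proj₂ (sid (c v)) v w refl cw≡cv)
  ...   | x , v→x , cx≡cv = contradiction (classes≤outdeg v x v→x cx≡cv) (<⇒≱ deg<m)

  outdeg<classes⇒inDominating : ∀ v → outdeg D v < m → InDominatingVertex D v
  outdeg<classes⇒inDominating v deg<m w w≢v
    with proj₁ (sid (c v)) w (w≢v ∘ outdeg<classes⇒alone-in-class v deg<m w)
  ... | u , cu≡cv , w→u = u , outdeg<classes⇒alone-in-class v deg<m u cu≡cv , w→u

proposition4 : ∀ {n} (D : Digraph (suc n)) → Strong D → IsDsMinus D (suc (δ⁺ D))
    → Σ (Fin (suc n)) (λ v → InDominatingVertex D v)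
      × (∀ v → outdeg D v ≡ δ⁺ D → InDominatingVertex D v)
proposition4 D _ ((c , _ , sid) , _) =
  (v₀ , minimum-inDominating v₀ deg-v₀) , minimum-inDominating
  where
  minimum-inDominating : ∀ v → outdeg D v ≡ δ⁺ D → InDominatingVertex D v
  minimum-inDominating v deg≡δ =
    outdeg<classes⇒inDominating D c sid v (s≤s (≤-reflexive deg≡δ))
  v₀ : Fin _
  v₀ = proj₁ (minOver-attained (outdeg D))
  deg-v₀ : outdeg D v₀ ≡ δ⁺ D
  deg-v₀ = proj₂ (minOver-attained (outdeg D))
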